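{- Let $G=(V,E)$ be a complete loopless directed graph with edge weights $w:E\to\{0,1\}$, let $M_{max}$ be a maximum weight matching of $G$, and let $G'$ be the undirected weighted graph constructed from $G$ and $M_{max}$ as described in the context. Then (1) every perfect matching of $G'$ yields (via the correspondence described in the context) a cycle cover of $G$ that evades $M_{max}$; and (2) a maximum weight perfect matching of $G'$ yields a cycle cover $C_{max}$ of $G$ that evades $M_{max}$ such that $w(C_{max})\ge \mathrm{OPT}$, where $\mathrm{OPT}$ is the maximum weight of a traveling salesman tour (directed Hamiltonian cycle) of $G$.
   Context: A matching of a directed graph is a set of pairwise vertex-disjoint edges; its weight is the sum of its edge weights. Let $G_1$ be the subgraph of $G$ consisting of the edges of weight one. For a matching $M$, a $2$-cycle of $G_1$ (a pair of edges $(u,v),(v,u)$ both of weight one) is called $M$-hit if one of its two edges belongs to $M$. Let $\tilde G=(\tilde V,\tilde E)$ be obtained from $G$ by subdividing each edge $(u,v)$ belonging to an $M$-hit $2$-cycle of $G_1$ by a new vertex $x_{(u,v)}$ into two edges $(u,x_{(u,v)})$ and $(x_{(u,v)},v)$, each of weight $\frac12 w(u,v)$; these are called half-edges of $(u,v)$. All other edges of $G$ are kept with their weights. A cycle cover that evades $M$ is a subset $\tilde C\subseteq\tilde E$ such that (i) each vertex of $V$ has exactly one outgoing and exactly one incoming edge in $\tilde C$; (ii) for each $M$-hit $2$-cycle of $G_1$ on vertices $u,v$, $\tilde C$ contains either zero or two edges from $\{(u,x_{(u,v)}),(x_{(u,v)},v),(v,x_{(v,u)}),(x_{(v,u)},u)\}$,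 and if $\tilde C$ contains only one half-edge of $(u,v)$ then it also contains one half-edge of $(v,u)$, with one of these two half-edges incident with $u$ and the other incident with $v$. Its weight $w(\tilde C)$ is the sum of the weights of its elements. Construction of $G'=(V',E')$ (with $M=M_{max}$): for each $v\in V$ add vertices $v_{in},v_{out}$. For each edge $(u,v)\in E$ add vertices $e^1_{uv},e^2_{uv}$, an edge $\{e^1_{uv},e^2_{uv}\}$ of weight $0$, and edges $\{u_{out},e^1_{uv}\}$ and $\{v_{in},e^2_{uv}\}$, each of weight $\frac12 w(u,v)$. For each $M$-hit $2$-cycle of $G_1$ on vertices $u,v$ add vertices $a_{\{u,v\}},b_{\{u,v\}}$ and edges $\{a_{\{u,v\}},e^1_{uv}\}$, $\{a_{\{u,v\}},e^2_{vu}\}$, $\{b_{\{u,v\}},e^1_{vu}\}$, $\{b_{\{u,v\}},e^2_{uv}\}$, each of weight $0$. Correspondence: a perfect matching $N$ of $G'$ yields the set $\tilde C$ consisting of: each edge $(u,v)$ of $G$ not subdivided in $\tilde G$ such that $\{u_{out},e^1_{uv}\},\{v_{in},e^2_{uv}\}\in N$; and, for each subdivided edge $(u,v)$, the half-edge $(u,x_{(u,v)})$ if $\{u_{out},e^1_{uv}\}\in N$ and the half-edge $(x_{(u,v)},v)$ if $\{v_{in},e^2_{uv}\}\in N$. The weight of $\tilde C$ equals the weight of $N$. -}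

module Defs where

open import Data.Nat using (ℕ; zero; suc; _+_; _*_; _≤_)
open import Data.Fin using (Fin; zero; suc; _<_; _≟_)
open import Data.Bool using (Bool; true; false; _∧_; _∨_; not)
open import Data.Product using (Σ; _×_; _,_; ∃)
open import Data.Sum using (_⊎_)
open import Data.Unit using (⊤)
open import Relation.Binary.PropositionalEquality using (_≡_; _≢_)
open import Relation.Nullary using (¬_)
open import Relation.Nullary.Decidable using (⌊_⌋)

𝟙 : Bool → ℕ
𝟙 true  = 1
𝟙 false = 0

ΣF : ∀ {n} → (Fin n → ℕ) → ℕ
ΣF {zero}  f = 0
ΣF {suc n} f = f zero + ΣF (λ i → f (suc i))

ExactlyOne : (A : Set) → (A → Set) → Set
ExactlyOne A P = Σ A (λ a → P a × (∀ b → P b → b ≡ a))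

iter : ∀ {A : Set} → (A → A) → ℕ → A → A
iter f zero    x = x
iter f (suc k) x = f (iter f k x)

-- The complete loopless digraph G on vertex set Fin n.
-- Its edges are the pairs (u , v) with u ≢ v.  Edge weights in {0,1}
-- are given by  w : Fin n → Fin n → Bool  (true = 1); the value on the
-- diagonal is irrelevant.  Edge subsets (e.g. a matching M) are given by
-- their characteristic function  Fin n → Fin n → Bool.

Rel : ℕ → Set
Rel n = Fin n → Fin n → Bool

IsMatching : ∀ {n} → Rel n → Set
IsMatching {n} M =
  (∀ (u v : Fin n) → M u v ≡ true → u ≢ v) ×
  (∀ (u v u' v' : Fin n) → M u v ≡ true → M u' v' ≡ true →
     ¬ ((u , v) ≡ (u' , v')) →
     (u ≢ u') × (u ≢ v') × (v ≢ u') × (v ≢ v'))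

weightM : ∀ {n} → Rel n → Rel n → ℕ
weightM w M = ΣF (λ u → ΣF (λ v → 𝟙 (M u v ∧ w u v)))

IsMaxWeightMatching : ∀ {n} → Rel n → Rel n → Set
IsMaxWeightMatching {n} w M =
  IsMatching M × (∀ (M' : Rel n) → IsMatching M' → weightM w M' ≤ weightM w M)

hit : ∀ {n} → Rel n → Rel n → Fin n → Fin n → Bool
hit w M u v = w u v ∧ w v u ∧ (M u v ∨ M v u)

-- The undirected graph G' (built from G, w and M).
-- Vertex names; `a u v` / `b u v` stand for a_{u,v}, b_{u,v} of the
-- unordered pair {u,v}, named by its ordered representative with u < v.

data V' (n : ℕ) : Set where
  vin vout : Fin n → V' n
  e1 e2    : Fin n → Fin n → V' n
  a b      : Fin n → Fin n → V' n

ValidV' : ∀ {n} → Rel n → Rel n → V' n → Set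
ValidV' w M (vin v)  = ⊤
ValidV' w M (vout v) = ⊤
ValidV' w M (e1 u v) = u ≢ v
ValidV' w M (e2 u v) = u ≢ v
ValidV' w M (a u v)  = (u < v) × (hit w M u v ≡ true)
ValidV' w M (b u v)  = (u < v) × (hit w M u v ≡ true)

data E' (n : ℕ) : Set where
  eout ein emid     : Fin n → Fin n → E' n
  ea1 ea2 eb1 eb2   : Fin n → Fin n → E' n

ValidE' : ∀ {n} → Rel n → Rel n → E' n → Set
ValidE' w M (eout u v) = u ≢ v
ValidE' w M (ein u v)  = u ≢ v
ValidE' w M (emid u v) = u ≢ v
ValidE' w M (ea1 u v)  = (u < v) × (hit w M u v ≡ true)
ValidE' w M (ea2 u v)  = (u < v) × (hit w M u v ≡ true)
ValidE' w M (eb1 u v)  = (u < v) × (hit w M u v ≡ true)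
ValidE' w M (eb2 u v)  = (u < v) × (hit w M u v ≡ true)

end₁ end₂ : ∀ {n} → E' n → V' n
end₁ (eout u v) = vout u
end₁ (ein u v)  = vin v
end₁ (emid u v) = e1 u v
end₁ (ea1 u v)  = a u v
end₁ (ea2 u v)  = a u v
end₁ (eb1 u v)  = b u v
end₁ (eb2 u v)  = b u v
end₂ (eout u v) = e1 u v
end₂ (ein u v)  = e2 u v
end₂ (emid u v) = e2 u v
end₂ (ea1 u v)  = e1 u v
end₂ (ea2 u v)  = e2 v u
end₂ (eb1 u v)  = e1 v u
end₂ (eb2 u v)  = e2 u v

IncE' : ∀ {n} → V' n → E' n → Set
IncE' x e = (x ≡ end₁ e) ⊎ (x ≡ end₂ e)

-- TWICE the weight of an edge of G' (to stay in ℕ: weights w/2 become w)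
wt2E' : ∀ {n} → Rel n → E' n → ℕ
wt2E' w (eout u v) = 𝟙 (w u v)
wt2E' w (ein u v)  = 𝟙 (w u v)
wt2E' w (emid u v) = 0
wt2E' w (ea1 u v)  = 0
wt2E' w (ea2 u v)  = 0
wt2E' w (eb1 u v)  = 0
wt2E' w (eb2 u v)  = 0

weight2N : ∀ {n} → Rel n → (E' n → Bool) → ℕ
weight2N w N = ΣF (λ u → ΣF (λ v →
    term (eout u v) + term (ein u v) + term (emid u v)
  + term (ea1 u v) + term (ea2 u v) + term (eb1 u v) + term (eb2 u v)))
  where
  term : _ → ℕ
  term e = 𝟙 (N e) * wt2E' w e

IsPerfectMatching' : ∀ {n} → Rel n → Rel n → (E' n → Bool) → Set
IsPerfectMatching' {n} w M N =
  (∀ e → N e ≡ true → ValidE' w M e) ×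
  (∀ (x : V' n) → ValidV' w M x →
     ExactlyOne (E' n) (λ e → (N e ≡ true) × IncE' x e))

IsMaxWeightPerfectMatching' : ∀ {n} → Rel n → Rel n → (E' n → Bool) → Set
IsMaxWeightPerfectMatching' {n} w M N =
  IsPerfectMatching' w M N ×
  (∀ (N' : E' n → Bool) → IsPerfectMatching' w M N' → weight2N w N' ≤ weight2N w N)

data Ṽ (n : ℕ) : Set where
  orig : Fin n → Ṽ n
  xv   : Fin n → Fin n → Ṽ n

data Ẽ (n : ℕ) : Set where
  full  : Fin n → Fin n → Ẽ n
  halfL : Fin n → Fin n → Ẽ n
  halfR : Fin n → Fin n → Ẽ n

ValidẼ : ∀ {n} → Rel n → Rel n → Ẽ n → Set
ValidẼ w M (full u v)  = (u ≢ v) × (hit w M u v ≡ false)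
ValidẼ w M (halfL u v) = (u ≢ v) × (hit w M u v ≡ true)
ValidẼ w M (halfR u v) = (u ≢ v) × (hit w M u v ≡ true)

src tgt : ∀ {n} → Ẽ n → Ṽ n
src (full u v)  = orig u
src (halfL u v) = orig u
src (halfR u v) = xv u v
tgt (full u v)  = orig v
tgt (halfL u v) = xv u v
tgt (halfR u v) = orig v

IncẼ : ∀ {n} → Ṽ n → Ẽ n → Set
IncẼ x e = (x ≡ src e) ⊎ (x ≡ tgt e)

HalfOf : ∀ {n} → Fin n → Fin n → Ẽ n → Set
HalfOf u v h = (h ≡ halfL u v) ⊎ (h ≡ halfR u v)

IsEvadingCycleCover : ∀ {n} → Rel n → Rel n → (Ẽ n → Bool) → Set
IsEvadingCycleCover {n} w M C =
  (∀ e → C e ≡ true → ValidẼ w M e) ×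
  (∀ (v : Fin n) → ExactlyOne (Ẽ n) (λ e → (C e ≡ true) × (src e ≡ orig v))) ×
  (∀ (v : Fin n) → ExactlyOne (Ẽ n) (λ e → (C e ≡ true) × (tgt e ≡ orig v))) ×
  (∀ (u v : Fin n) → hit w M u v ≡ true →
     ((𝟙 (C (halfL u v)) + 𝟙 (C (halfR u v)) + 𝟙 (C (halfL v u)) + 𝟙 (C (halfR v u)) ≡ 0)
      ⊎ (𝟙 (C (halfL u v)) + 𝟙 (C (halfR u v)) + 𝟙 (C (halfL v u)) + 𝟙 (C (halfR v u)) ≡ 2))
     × (𝟙 (C (halfL u v)) + 𝟙 (C (halfR u v)) ≡ 1 →
        Σ (Ẽ n) λ h₁ → Σ (Ẽ n) λ h₂ →
          HalfOf u v h₁ × HalfOf v u h₂ × (C h₁ ≡ true) × (C h₂ ≡ true) ×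
          ((IncẼ (orig u) h₁ × IncẼ (orig v) h₂) ⊎ (IncẼ (orig v) h₁ × IncẼ (orig u) h₂))))

-- TWICE the weight of an edge of G̃ (half-edges of (u,v) weigh w(u,v)/2)
wt2Ẽ : ∀ {n} → Rel n → Ẽ n → ℕ
wt2Ẽ w (full u v)  = 2 * 𝟙 (w u v)
wt2Ẽ w (halfL u v) = 𝟙 (w u v)
wt2Ẽ w (halfR u v) = 𝟙 (w u v)

weight2C : ∀ {n} → Rel n → (Ẽ n → Bool) → ℕ
weight2C w C = ΣF (λ u → ΣF (λ v →
  term (full u v) + term (halfL u v) + term (halfR u v)))
  where
  term : _ → ℕ
  term e = 𝟙 (C e) * wt2Ẽ w e

corr : ∀ {n} → Rel n → Rel n → (E' n → Bool) → Ẽ n → Bool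
corr w M N (full u v)  = not ⌊ u ≟ v ⌋ ∧ not (hit w M u v) ∧ N (eout u v) ∧ N (ein u v)
corr w M N (halfL u v) = not ⌊ u ≟ v ⌋ ∧ hit w M u v ∧ N (eout u v)
corr w M N (halfR u v) = not ⌊ u ≟ v ⌋ ∧ hit w M u v ∧ N (ein u v)

-- Traveling salesman tours = directed Hamiltonian cycles of G, given by
-- the successor map s (the tour uses the edges (v , s v)): no loops and
-- every vertex is reached from every vertex by following the tour.

IsHamiltonianCycle : ∀ {n} → (Fin n → Fin n) → Set
IsHamiltonianCycle {n} s =
  (∀ (v : Fin n) → s v ≢ v) ×
  (∀ (u v : Fin n) → ∃ λ k → iter s (suc k) u ≡ v)

tourWeight2 : ∀ {n} → Rel n → (Fin n → Fin n) → ℕ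
tourWeight2 w s = 2 * ΣF (λ v → 𝟙 (w v (s v)))

-- A perfect matching N of G' chooses at every v_out one edge leaving v and at every v_in one
-- edge entering v.  At e¹uv and e²uv the only alternatives are the middle edge and the gadget
-- edges, so for a pair without gadget the tail and the head of (u,v) are chosen together, while
-- the gadget of an M-hit 2-cycle has exactly five perfect local states; these are precisely the
-- half-edge patterns an evading cycle cover allows.  Gadget edges weigh nothing, so corr N
-- weighs as much as N.  Conversely, a tour that does not run through both edges of an M-hit
-- 2-cycle extends to a perfect matching of G' of its own weight (each gadget takes the
-- e-vertices of a direction of its pair that the tour does not use); a tour that does run
-- through such a 2-cycle has two vertices only, and then G' has no perfect matching at all.
-- Maximality of N therefore bounds every tour by the weight of corr N.
module Submission where

open import Defs
open import Data.Nat using (ℕ; zero; suc; _+_; _*_; _≤_; z≤n)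
open import Data.Nat.Properties
  using (≤-trans; ≤-reflexive; m≤m+n; m≤n+m; +-mono-≤; *-zeroʳ; *-distribˡ-+; 1+n≰n; ≮⇒≥; module ≤-Reasoning)
open import Data.Nat.Tactic.RingSolver using (solve-∀)
open import Data.Fin using (Fin; zero; suc; _<_; _≟_; _<?_; punchOut)
open import Data.Fin.Properties using (any?; punchOut-injective; injective⇒≤; <-asym; <-cmp; ≤-antisym)
open import Data.Bool using (Bool; true; false; _∧_; not; if_then_else_)
open import Data.Bool.Properties using (¬-not; ∨-comm; ∨-idem; ∧-conicalˡ; ∧-conicalʳ)
open import Data.List using (List; []; _∷_; map)
open import Data.List.Membership.Propositional using (_∈_)
open import Data.List.Relation.Unary.All as All using (All; []; _∷_)
open import Data.List.Relation.Unary.All.Properties as All using ()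
open import Data.List.Relation.Unary.Any using (here; there)
open import Data.List.Relation.Unary.Unique.Propositional using (Unique; []; _∷_)
open import Data.Product using (Σ; _×_; _,_; ∃; proj₁; proj₂)
open import Data.Sum using (_⊎_; inj₁; inj₂)
import Data.Sum as Sum
open import Data.Unit using (tt)
open import Function using (_∘_)
open import Function.Definitions using (Injective)
open import Relation.Binary.Definitions using (tri<; tri≈; tri>)
open import Relation.Binary.PropositionalEquality
  using (_≡_; _≢_; refl; sym; trans; cong; cong₂; subst; module ≡-Reasoning)
open import Relation.Nullary using (¬_; yes; no; contradiction)
open import Relation.Nullary.Decidable using (⌊_⌋)

ΣF-cong : ∀ {n} {f g : Fin n → ℕ} → (∀ i → f i ≡ g i) → ΣF f ≡ ΣF g
ΣF-cong {zero}  f≗g = refl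
ΣF-cong {suc n} f≗g = cong₂ _+_ (f≗g zero) (ΣF-cong (f≗g ∘ suc))

ΣF-mono : ∀ {n} {f g : Fin n → ℕ} → (∀ i → f i ≤ g i) → ΣF f ≤ ΣF g
ΣF-mono {zero}  f≤g = z≤n
ΣF-mono {suc n} f≤g = +-mono-≤ (f≤g zero) (ΣF-mono (f≤g ∘ suc))

*-distribˡ-ΣF : ∀ {n} k (f : Fin n → ℕ) → k * ΣF f ≡ ΣF (λ i → k * f i)
*-distribˡ-ΣF {zero}  k f = *-zeroʳ k
*-distribˡ-ΣF {suc n} k f =
  trans (*-distribˡ-+ k (f zero) _) (cong (k * f zero +_) (*-distribˡ-ΣF k (f ∘ suc)))

≤-ΣF : ∀ {n} (f : Fin n → ℕ) i → f i ≤ ΣF f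
≤-ΣF f zero    = m≤m+n (f zero) _
≤-ΣF f (suc i) = ≤-trans (≤-ΣF (f ∘ suc) i) (m≤n+m _ (f zero))

Enumerates : ∀ {A : Set} → (A → Set) → List A → Set
Enumerates P cs = Unique cs × All P cs × (∀ x → P x → x ∈ cs)

data OneHot : List Bool → Set where
  hot  : ∀ {bs} → All (_≡ false) bs → OneHot (true ∷ bs)
  cold : ∀ {bs} → OneHot bs → OneHot (false ∷ bs)

module _ {A : Set} (P : A → Set) (f : A → Bool) where

  Covers : List A → Set
  Covers cs = ∀ x → f x ≡ true → P x → x ∈ cs

  private
    covers-tail : ∀ {c cs} → f c ≡ false → Covers (c ∷ cs) → Covers cs
    covers-tail fc≡false cover x fx px with cover x fx px
    ... | here x≡c   = contradiction (trans (sym fx) (trans (cong f x≡c) fc≡false)) λ ()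
    ... | there x∈cs = x∈cs

  exactlyOne⇒oneHot : ∀ cs → Unique cs → All P cs → Covers cs →
    ExactlyOne A (λ x → f x ≡ true × P x) → OneHot (map f cs)
  exactlyOne⇒oneHot [] _ _ cover (x , (fx , px) , _) with () ← cover x fx px
  exactlyOne⇒oneHot (c ∷ cs) (c∉cs ∷ unique) (pc ∷ pcs) cover one@(_ , _ , only) with f c in fc
  ... | true  = hot (All.map⁺ (All.zipWith othersFalse (c∉cs , pcs)))
    where
    othersFalse : ∀ {c′} → c ≢ c′ × P c′ → f c′ ≡ false
    othersFalse (c≢c′ , pc′) = ¬-not λ fc′ → c≢c′ (trans (only c (fc , pc)) (sym (only _ (fc′ , pc′))))
  ... | false = cold (exactlyOne⇒oneHot cs unique pcs (covers-tail fc cover) one)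

  oneHot⇒exactlyOne : ∀ cs → All P cs → Covers cs → OneHot (map f cs) →
    ExactlyOne A (λ x → f x ≡ true × P x)
  oneHot⇒exactlyOne (c ∷ cs) (pc ∷ pcs) cover oneHot with f c in fc | oneHot
  ... | true  | hot othersFalse = c , (fc , pc) , only
    where
    only : ∀ x → f x ≡ true × P x → x ≡ c
    only x (fx , px) with cover x fx px
    ... | here x≡c   = x≡c
    ... | there x∈cs = contradiction (trans (sym fx) (All.lookup (All.map⁻ othersFalse) x∈cs)) λ ()
  ... | false | cold oneHot′ = oneHot⇒exactlyOne cs pcs (covers-tail fc cover) oneHot′

data OneOf₂ : Bool → Bool → Set where
  1st : OneOf₂ true false
  2nd : OneOf₂ false true

data OneOf₄ : Bool → Bool → Bool → Bool → Set where
  1st : OneOf₄ true false false false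
  2nd : OneOf₄ false true false false
  3rd : OneOf₄ false false true false
  4th : OneOf₄ false false false true

oneHot⇒oneOf₂ : ∀ {x y} → OneHot (x ∷ y ∷ []) → OneOf₂ x y
oneHot⇒oneOf₂ (hot (refl ∷ [])) = 1st
oneHot⇒oneOf₂ (cold (hot []))   = 2nd

oneOf₂⇒oneHot : ∀ {x y} → OneOf₂ x y → OneHot (x ∷ y ∷ [])
oneOf₂⇒oneHot 1st = hot (refl ∷ [])
oneOf₂⇒oneHot 2nd = cold (hot [])

oneHot⇒oneOf₄ : ∀ {x y z t} → OneHot (x ∷ y ∷ z ∷ t ∷ []) → OneOf₄ x y z t
oneHot⇒oneOf₄ (hot (refl ∷ refl ∷ refl ∷ [])) = 1st
oneHot⇒oneOf₄ (cold (hot (refl ∷ refl ∷ [])))  = 2nd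
oneHot⇒oneOf₄ (cold (cold (hot (refl ∷ []))))  = 3rd
oneHot⇒oneOf₄ (cold (cold (cold (hot []))))    = 4th

oneOf₄⇒oneHot : ∀ {x y z t} → OneOf₄ x y z t → OneHot (x ∷ y ∷ z ∷ t ∷ [])
oneOf₄⇒oneHot 1st = hot (refl ∷ refl ∷ refl ∷ [])
oneOf₄⇒oneHot 2nd = cold (hot (refl ∷ refl ∷ []))
oneOf₄⇒oneHot 3rd = cold (cold (hot (refl ∷ [])))
oneOf₄⇒oneHot 4th = cold (cold (cold (hot [])))

injective⇒surjective : ∀ {n} {f : Fin n → Fin n} → Injective _≡_ _≡_ f → ∀ y → ∃ λ x → f x ≡ y
injective⇒surjective {suc m} {f} f-inj y with any? (λ x → f x ≟ y)
... | yes found = found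
... | no missed = contradiction (injective⇒≤ g-inj) 1+n≰n
  where
  y≢f : ∀ x → y ≢ f x
  y≢f x y≡fx = missed (x , sym y≡fx)
  g : Fin (suc m) → Fin m
  g x = punchOut (y≢f x)
  g-inj : Injective _≡_ _≡_ g
  g-inj {x} {x′} = f-inj ∘ punchOut-injective (y≢f x) (y≢f x′)

surjective⇒injective : ∀ {n} {f : Fin n → Fin n} → (∀ y → ∃ λ x → f x ≡ y) → Injective _≡_ _≡_ f
surjective⇒injective {f = f} f-surj {x} {y} fx≡fy =
  trans (sym (r∘f≗id x)) (trans (cong r fx≡fy) (r∘f≗id y))
  where
  open ≡-Reasoning
  r : _ → _
  r y = proj₁ (f-surj y)
  f∘r≗id : ∀ y → f (r y) ≡ y
  f∘r≗id y = proj₂ (f-surj y)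
  r-inj : Injective _≡_ _≡_ r
  r-inj {y} {y′} ry≡ry′ = trans (sym (f∘r≗id y)) (trans (cong f ry≡ry′) (f∘r≗id y′))
  r∘f≗id : ∀ x → r (f x) ≡ x
  r∘f≗id x with z , rz≡x ← injective⇒surjective r-inj x =
    begin
      r (f x)       ≡⟨ cong (r ∘ f) (sym rz≡x) ⟩
      r (f (r z))   ≡⟨ cong r (f∘r≗id z) ⟩
      r z           ≡⟨ rz≡x ⟩
      x             ∎

module _ {n : ℕ} (w M : Rel n) where

  hit-sym : ∀ u v → hit w M u v ≡ hit w M v u
  hit-sym u v with w u v | w v u
  ... | true  | true  = ∨-comm (M u v) (M v u)
  ... | true  | false = refl
  ... | false | true  = refl
  ... | false | false = refl

  hit⇒≢ : IsMatching M → ∀ {u v} → hit w M u v ≡ true → u ≢ v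
  hit⇒≢ (loopless , _) {u} h refl =
    loopless u u (trans (sym (∨-idem (M u u))) (∧-conicalʳ (w u u) _ (∧-conicalʳ (w u u) _ h))) refl

module _ {n : ℕ} where

  e1-edges e2-edges a-edges b-edges : Fin n → Fin n → List (E' n)
  e1-edges u v = eout u v ∷ emid u v ∷ ea1 u v ∷ eb1 v u ∷ []
  e2-edges u v = ein u v ∷ emid u v ∷ eb2 u v ∷ ea2 v u ∷ []
  a-edges p q = ea1 p q ∷ ea2 p q ∷ []
  b-edges p q = eb1 p q ∷ eb2 p q ∷ []

  e1-enumerates : ∀ {u v} → Enumerates (IncE' (e1 u v)) (e1-edges u v)
  e1-enumerates {u} {v} =
    ((λ ()) ∷ (λ ()) ∷ (λ ()) ∷ []) ∷ ((λ ()) ∷ (λ ()) ∷ []) ∷ ((λ ()) ∷ []) ∷ [] ∷ [] ,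
    inj₂ refl ∷ inj₁ refl ∷ inj₂ refl ∷ inj₂ refl ∷ [] ,
    incident
    where
    incident : ∀ e → IncE' (e1 u v) e → e ∈ e1-edges u v
    incident (eout _ _) = λ { (inj₁ ()) ; (inj₂ refl) → here refl }
    incident (ein _ _)  = λ { (inj₁ ()) ; (inj₂ ()) }
    incident (emid _ _) = λ { (inj₁ refl) → there (here refl) ; (inj₂ ()) }
    incident (ea1 _ _)  = λ { (inj₁ ()) ; (inj₂ refl) → there (there (here refl)) }
    incident (ea2 _ _)  = λ { (inj₁ ()) ; (inj₂ ()) }
    incident (eb1 _ _)  = λ { (inj₁ ()) ; (inj₂ refl) → there (there (there (here refl))) }
    incident (eb2 _ _)  = λ { (inj₁ ()) ; (inj₂ ()) }

  e2-enumerates : ∀ {u v} → Enumerates (IncE' (e2 u v)) (e2-edges u v)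
  e2-enumerates {u} {v} =
    ((λ ()) ∷ (λ ()) ∷ (λ ()) ∷ []) ∷ ((λ ()) ∷ (λ ()) ∷ []) ∷ ((λ ()) ∷ []) ∷ [] ∷ [] ,
    inj₂ refl ∷ inj₂ refl ∷ inj₂ refl ∷ inj₂ refl ∷ [] ,
    incident
    where
    incident : ∀ e → IncE' (e2 u v) e → e ∈ e2-edges u v
    incident (eout _ _) = λ { (inj₁ ()) ; (inj₂ ()) }
    incident (ein _ _)  = λ { (inj₁ ()) ; (inj₂ refl) → here refl }
    incident (emid _ _) = λ { (inj₁ ()) ; (inj₂ refl) → there (here refl) }
    incident (ea1 _ _)  = λ { (inj₁ ()) ; (inj₂ ()) }
    incident (ea2 _ _)  = λ { (inj₁ ()) ; (inj₂ refl) → there (there (there (here refl))) }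
    incident (eb1 _ _)  = λ { (inj₁ ()) ; (inj₂ ()) }
    incident (eb2 _ _)  = λ { (inj₁ ()) ; (inj₂ refl) → there (there (here refl)) }

  a-enumerates : ∀ {p q} → Enumerates (IncE' (a p q)) (a-edges p q)
  a-enumerates {p} {q} = ((λ ()) ∷ []) ∷ [] ∷ [] , inj₁ refl ∷ inj₁ refl ∷ [] , incident
    where
    incident : ∀ e → IncE' (a p q) e → e ∈ a-edges p q
    incident (eout _ _) = λ { (inj₁ ()) ; (inj₂ ()) }
    incident (ein _ _)  = λ { (inj₁ ()) ; (inj₂ ()) }
    incident (emid _ _) = λ { (inj₁ ()) ; (inj₂ ()) }
    incident (ea1 _ _)  = λ { (inj₁ refl) → here refl ; (inj₂ ()) }
    incident (ea2 _ _)  = λ { (inj₁ refl) → there (here refl) ; (inj₂ ()) }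
    incident (eb1 _ _)  = λ { (inj₁ ()) ; (inj₂ ()) }
    incident (eb2 _ _)  = λ { (inj₁ ()) ; (inj₂ ()) }

  b-enumerates : ∀ {p q} → Enumerates (IncE' (b p q)) (b-edges p q)
  b-enumerates {p} {q} = ((λ ()) ∷ []) ∷ [] ∷ [] , inj₁ refl ∷ inj₁ refl ∷ [] , incident
    where
    incident : ∀ e → IncE' (b p q) e → e ∈ b-edges p q
    incident (eout _ _) = λ { (inj₁ ()) ; (inj₂ ()) }
    incident (ein _ _)  = λ { (inj₁ ()) ; (inj₂ ()) }
    incident (emid _ _) = λ { (inj₁ ()) ; (inj₂ ()) }
    incident (ea1 _ _)  = λ { (inj₁ ()) ; (inj₂ ()) }
    incident (ea2 _ _)  = λ { (inj₁ ()) ; (inj₂ ()) }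
    incident (eb1 _ _)  = λ { (inj₁ refl) → here refl ; (inj₂ ()) }
    incident (eb2 _ _)  = λ { (inj₁ refl) → there (here refl) ; (inj₂ ()) }

  incident-vout : ∀ {u : Fin n} e → IncE' (vout u) e → ∃ λ v → e ≡ eout u v
  incident-vout (eout _ v) = λ { (inj₁ refl) → v , refl ; (inj₂ ()) }
  incident-vout (ein _ _)  = λ { (inj₁ ()) ; (inj₂ ()) }
  incident-vout (emid _ _) = λ { (inj₁ ()) ; (inj₂ ()) }
  incident-vout (ea1 _ _)  = λ { (inj₁ ()) ; (inj₂ ()) }
  incident-vout (ea2 _ _)  = λ { (inj₁ ()) ; (inj₂ ()) }
  incident-vout (eb1 _ _)  = λ { (inj₁ ()) ; (inj₂ ()) }
  incident-vout (eb2 _ _)  = λ { (inj₁ ()) ; (inj₂ ()) }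

  incident-vin : ∀ {v : Fin n} e → IncE' (vin v) e → ∃ λ u → e ≡ ein u v
  incident-vin (eout _ _) = λ { (inj₁ ()) ; (inj₂ ()) }
  incident-vin (ein u _)  = λ { (inj₁ refl) → u , refl ; (inj₂ ()) }
  incident-vin (emid _ _) = λ { (inj₁ ()) ; (inj₂ ()) }
  incident-vin (ea1 _ _)  = λ { (inj₁ ()) ; (inj₂ ()) }
  incident-vin (ea2 _ _)  = λ { (inj₁ ()) ; (inj₂ ()) }
  incident-vin (eb1 _ _)  = λ { (inj₁ ()) ; (inj₂ ()) }
  incident-vin (eb2 _ _)  = λ { (inj₁ ()) ; (inj₂ ()) }

-- GadgetUse o i o′ i′ : which of the half-edges (u,x_uv), (x_uv,v), (v,x_vu), (x_vu,u) are used.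
data GadgetUse : Bool → Bool → Bool → Bool → Set where
  idle     : GadgetUse false false false false
  forward  : GadgetUse true  true  false false
  backward : GadgetUse false false true  true
  leaving  : GadgetUse true  false true  false
  entering : GadgetUse false true  false true

GadgetUse-swap : ∀ {o i o′ i′} → GadgetUse o i o′ i′ → GadgetUse o′ i′ o i
GadgetUse-swap idle     = idle
GadgetUse-swap forward  = backward
GadgetUse-swap backward = forward
GadgetUse-swap leaving  = leaving
GadgetUse-swap entering = entering

GadgetUse-notAll : ∀ {o i o′ i′} → GadgetUse o i o′ i′ → o ≡ true → i ≡ true → o′ ≡ true → i′ ≢ true
GadgetUse-notAll idle     ()
GadgetUse-notAll forward  _ _ ()
GadgetUse-notAll backward ()
GadgetUse-notAll leaving  _ ()
GadgetUse-notAll entering ()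

-- The perfect-matching conditions at a, b, e¹pq, e²pq, e¹qp, e²qp of the gadget of p < q;
-- the fixed false entries are the edges of the nonexistent gadget named (q,p).
gadgetUse : ∀ {o i o′ i′ m m′ a₁ a₂ b₁ b₂} →
  OneOf₂ a₁ a₂ → OneOf₂ b₁ b₂ →
  OneOf₄ o m a₁ false → OneOf₄ i m b₂ false → OneOf₄ o′ m′ false b₁ → OneOf₄ i′ m′ false a₂ →
  GadgetUse o i o′ i′
gadgetUse 1st 1st 3rd 1st 4th 1st = entering
gadgetUse 1st 2nd 3rd 3rd 1st 1st = backward
gadgetUse 1st 2nd 3rd 3rd 2nd 2nd = idle
gadgetUse 2nd 1st 1st 1st 4th 4th = forward
gadgetUse 2nd 1st 2nd 2nd 4th 4th = idle
gadgetUse 2nd 2nd 1st 3rd 1st 4th = leaving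

clear₃ : ∀ {x y z t} → z ≡ false → OneOf₄ x y z t → OneOf₄ x y false t
clear₃ refl one = one

clear₄ : ∀ {x y z t} → t ≡ false → OneOf₄ x y z t → OneOf₄ x y z false
clear₄ refl one = one

sharedMiddle : ∀ {o i m} → OneOf₄ o m false false → OneOf₄ i m false false → o ≡ i
sharedMiddle 1st 1st = refl
sharedMiddle 2nd 2nd = refl

EvadesAt : ∀ {n} → (Ẽ n → Bool) → Fin n → Fin n → Set
EvadesAt {n} C u v =
  ((𝟙 (C (halfL u v)) + 𝟙 (C (halfR u v)) + 𝟙 (C (halfL v u)) + 𝟙 (C (halfR v u)) ≡ 0)
   ⊎ (𝟙 (C (halfL u v)) + 𝟙 (C (halfR u v)) + 𝟙 (C (halfL v u)) + 𝟙 (C (halfR v u)) ≡ 2))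
  × (𝟙 (C (halfL u v)) + 𝟙 (C (halfR u v)) ≡ 1 →
     Σ (Ẽ n) λ h₁ → Σ (Ẽ n) λ h₂ →
       HalfOf u v h₁ × HalfOf v u h₂ × (C h₁ ≡ true) × (C h₂ ≡ true) ×
       ((IncẼ (orig u) h₁ × IncẼ (orig v) h₂) ⊎ (IncẼ (orig v) h₁ × IncẼ (orig u) h₂)))

GadgetUse⇒EvadesAt : ∀ {n} (C : Ẽ n → Bool) {u v o i o′ i′} → GadgetUse o i o′ i′ →
  C (halfL u v) ≡ o → C (halfR u v) ≡ i → C (halfL v u) ≡ o′ → C (halfR v u) ≡ i′ → EvadesAt C u v
GadgetUse⇒EvadesAt C idle     l r l′ r′ rewrite l | r | l′ | r′ = inj₁ refl , λ ()
GadgetUse⇒EvadesAt C forward  l r l′ r′ rewrite l | r | l′ | r′ = inj₂ refl , λ ()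
GadgetUse⇒EvadesAt C backward l r l′ r′ rewrite l | r | l′ | r′ = inj₂ refl , λ ()
GadgetUse⇒EvadesAt C {u} {v} leaving l r l′ r′ rewrite l | r | l′ | r′ =
  inj₂ refl , λ _ → halfL u v , halfL v u , inj₁ refl , inj₁ refl , l , l′ , inj₁ (inj₁ refl , inj₁ refl)
GadgetUse⇒EvadesAt C {u} {v} entering l r l′ r′ rewrite l | r | l′ | r′ =
  inj₂ refl , λ _ → halfR u v , halfR v u , inj₂ refl , inj₂ refl , r , r′ , inj₂ (inj₂ refl , inj₂ refl)

period2⇒twoPoints : ∀ {n} {s : Fin n → Fin n} → IsHamiltonianCycle s →
  ∀ {u} → s (s u) ≡ u → ∀ x → x ≡ u ⊎ x ≡ s u
period2⇒twoPoints {s = s} (_ , reaches) {u} ssu≡u x with k , sᵏ⁺¹u≡x ← reaches u x =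
  Sum.map (trans (sym sᵏ⁺¹u≡x)) (trans (sym sᵏ⁺¹u≡x)) (orbit (suc k))
  where
  orbit : ∀ k → iter s k u ≡ u ⊎ iter s k u ≡ s u
  orbit zero    = inj₁ refl
  orbit (suc k) with orbit k
  ... | inj₁ sᵏu≡u  = inj₂ (cong s sᵏu≡u)
  ... | inj₂ sᵏu≡su = inj₁ (trans (cong s sᵏu≡su) ssu≡u)

weight2N≡Σ-eout-ein : ∀ {n} (w : Rel n) (N : E' n → Bool) →
  weight2N w N ≡ ΣF (λ u → ΣF (λ v → 𝟙 (N (eout u v)) * 𝟙 (w u v) + 𝟙 (N (ein u v)) * 𝟙 (w u v)))
weight2N≡Σ-eout-ein w N = ΣF-cong λ u → ΣF-cong λ v → zeros
  (𝟙 (N (eout u v)) * 𝟙 (w u v) + 𝟙 (N (ein u v)) * 𝟙 (w u v))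
  (𝟙 (N (emid u v))) (𝟙 (N (ea1 u v))) (𝟙 (N (ea2 u v))) (𝟙 (N (eb1 u v))) (𝟙 (N (eb2 u v)))
  where
  zeros : ∀ x y₁ y₂ y₃ y₄ y₅ → x + y₁ * 0 + y₂ * 0 + y₃ * 0 + y₄ * 0 + y₅ * 0 ≡ x
  zeros = solve-∀

module PerfectMatching {n} {w M : Rel n} (M-matching : IsMatching M)
                       {N : E' n → Bool} (N-perfect : IsPerfectMatching' w M N) where

  C : Ẽ n → Bool
  C = corr w M N

  N-valid : ∀ {e} → N e ≡ true → ValidE' w M e
  N-valid = proj₁ N-perfect _

  N-invalid : ∀ {e} → ¬ ValidE' w M e → N e ≡ false
  N-invalid ¬valid = ¬-not (¬valid ∘ N-valid)

  oneHotAt : ∀ {x cs} → ValidV' w M x → Enumerates (IncE' x) cs → OneHot (map N cs)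
  oneHotAt {x} {cs} x-valid (unique , incident , enumerated) =
    exactlyOne⇒oneHot (IncE' x) N cs unique incident (λ e _ → enumerated e) (proj₂ N-perfect x x-valid)

  N-e1 : ∀ {u v} → u ≢ v → OneOf₄ (N (eout u v)) (N (emid u v)) (N (ea1 u v)) (N (eb1 v u))
  N-e1 u≢v = oneHot⇒oneOf₄ (oneHotAt u≢v e1-enumerates)

  N-e2 : ∀ {u v} → u ≢ v → OneOf₄ (N (ein u v)) (N (emid u v)) (N (eb2 u v)) (N (ea2 v u))
  N-e2 u≢v = oneHot⇒oneOf₄ (oneHotAt u≢v e2-enumerates)

  N-a : ∀ {p q} → p < q → hit w M p q ≡ true → OneOf₂ (N (ea1 p q)) (N (ea2 p q))
  N-a p<q h = oneHot⇒oneOf₂ (oneHotAt (p<q , h) a-enumerates)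

  N-b : ∀ {p q} → p < q → hit w M p q ≡ true → OneOf₂ (N (eb1 p q)) (N (eb2 p q))
  N-b p<q h = oneHot⇒oneOf₂ (oneHotAt (p<q , h) b-enumerates)

  nonHit-noGadget : ∀ {p q} → hit w M p q ≡ false → ∀ {X : Set} → ¬ (X × hit w M p q ≡ true)
  nonHit-noGadget h (_ , h′) = contradiction (trans (sym h′) h) λ ()

  out≡in : ∀ {u v} → u ≢ v → hit w M u v ≡ false → N (eout u v) ≡ N (ein u v)
  out≡in {u} {v} u≢v h = sharedMiddle
    (clear₃ (N-invalid {ea1 u v} (nonHit-noGadget h)) (clear₄ (N-invalid {eb1 v u} (nonHit-noGadget h′)) (N-e1 u≢v)))
    (clear₃ (N-invalid {eb2 u v} (nonHit-noGadget h)) (clear₄ (N-invalid {ea2 v u} (nonHit-noGadget h′)) (N-e2 u≢v)))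
    where
    h′ : hit w M v u ≡ false
    h′ = trans (hit-sym w M v u) h

  reversed-noGadget : ∀ {p q : Fin n} → p < q → ∀ {X : Set} → ¬ (q < p × X)
  reversed-noGadget p<q (q<p , _) = <-asym p<q q<p

  gadgetAt : ∀ {p q} → p < q → hit w M p q ≡ true →
    GadgetUse (N (eout p q)) (N (ein p q)) (N (eout q p)) (N (ein q p))
  gadgetAt {p} {q} p<q h = gadgetUse (N-a p<q h) (N-b p<q h)
    (clear₄ (N-invalid {eb1 q p} (reversed-noGadget p<q)) (N-e1 p≢q))
    (clear₄ (N-invalid {ea2 q p} (reversed-noGadget p<q)) (N-e2 p≢q))
    (clear₃ (N-invalid {ea1 q p} (reversed-noGadget p<q)) (N-e1 (p≢q ∘ sym)))
    (clear₃ (N-invalid {eb2 q p} (reversed-noGadget p<q)) (N-e2 (p≢q ∘ sym)))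
    where
    p≢q : p ≢ q
    p≢q = hit⇒≢ w M M-matching h

  gadget : ∀ {u v} → hit w M u v ≡ true →
    GadgetUse (N (eout u v)) (N (ein u v)) (N (eout v u)) (N (ein v u))
  gadget {u} {v} h with <-cmp u v
  ... | tri< u<v _ _ = gadgetAt u<v h
  ... | tri≈ _ u≡v _ = contradiction u≡v (hit⇒≢ w M M-matching h)
  ... | tri> _ _ v<u = GadgetUse-swap (gadgetAt v<u (trans (hit-sym w M v u) h))

  corr-valid : ∀ e → C e ≡ true → ValidẼ w M e
  corr-valid (full u v) with u ≟ v | hit w M u v
  ... | yes _   | _     = λ ()
  ... | no u≢v  | false = λ _ → u≢v , refl
  ... | no _    | true  = λ ()
  corr-valid (halfL u v) with u ≟ v | hit w M u v
  ... | yes _   | _     = λ ()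
  ... | no u≢v  | true  = λ _ → u≢v , refl
  ... | no _    | false = λ ()
  corr-valid (halfR u v) with u ≟ v | hit w M u v
  ... | yes _   | _     = λ ()
  ... | no u≢v  | true  = λ _ → u≢v , refl
  ... | no _    | false = λ ()

  corr-full : ∀ {u v} → u ≢ v → hit w M u v ≡ false → C (full u v) ≡ N (eout u v) ∧ N (ein u v)
  corr-full {u} {v} u≢v h with u ≟ v
  ... | yes u≡v = contradiction u≡v u≢v
  ... | no _ rewrite h = refl

  corr-halfL : ∀ {u v} → u ≢ v → hit w M u v ≡ true → C (halfL u v) ≡ N (eout u v)
  corr-halfL {u} {v} u≢v h with u ≟ v
  ... | yes u≡v = contradiction u≡v u≢v
  ... | no _ rewrite h = refl

  corr-halfR : ∀ {u v} → u ≢ v → hit w M u v ≡ true → C (halfR u v) ≡ N (ein u v)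
  corr-halfR {u} {v} u≢v h with u ≟ v
  ... | yes u≡v = contradiction u≡v u≢v
  ... | no _ rewrite h = refl

  tailEdge headEdge : Fin n → Fin n → Ẽ n
  tailEdge u v = if hit w M u v then halfL u v else full u v
  headEdge u v = if hit w M u v then halfR u v else full u v

  tailEdge-nonHit : ∀ {u v} → hit w M u v ≡ false → full u v ≡ tailEdge u v
  tailEdge-nonHit h rewrite h = refl

  headEdge-nonHit : ∀ {u v} → hit w M u v ≡ false → full u v ≡ headEdge u v
  headEdge-nonHit h rewrite h = refl

  tailEdge-hit : ∀ {u v} → hit w M u v ≡ true → halfL u v ≡ tailEdge u v
  tailEdge-hit h rewrite h = refl

  headEdge-hit : ∀ {u v} → hit w M u v ≡ true → halfR u v ≡ headEdge u v
  headEdge-hit h rewrite h = refl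

  C-tailEdge : ∀ {u v} → u ≢ v → N (eout u v) ≡ true → C (tailEdge u v) ≡ true
  C-tailEdge {u} {v} u≢v Nout with hit w M u v in h
  ... | true  = trans (corr-halfL u≢v h) Nout
  ... | false = trans (corr-full u≢v h) (cong₂ _∧_ Nout (trans (sym (out≡in u≢v h)) Nout))

  C-headEdge : ∀ {u v} → u ≢ v → N (ein u v) ≡ true → C (headEdge u v) ≡ true
  C-headEdge {u} {v} u≢v Nin with hit w M u v in h
  ... | true  = trans (corr-halfR u≢v h) Nin
  ... | false = trans (corr-full u≢v h) (cong₂ _∧_ (trans (out≡in u≢v h) Nin) Nin)

  src-tailEdge : ∀ {u v} → src (tailEdge u v) ≡ orig u
  src-tailEdge {u} {v} with hit w M u v
  ... | true  = refl
  ... | false = refl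

  tgt-headEdge : ∀ {u v} → tgt (headEdge u v) ≡ orig v
  tgt-headEdge {u} {v} with hit w M u v
  ... | true  = refl
  ... | false = refl

  C-leaving : ∀ e {u} → C e ≡ true → src e ≡ orig u → ∃ λ v → N (eout u v) ≡ true × e ≡ tailEdge u v
  C-leaving (full u v) Ce refl with u≢v , h ← corr-valid (full u v) Ce =
    v , ∧-conicalˡ _ _ (trans (sym (corr-full u≢v h)) Ce) , tailEdge-nonHit h
  C-leaving (halfL u v) Ce refl with u≢v , h ← corr-valid (halfL u v) Ce =
    v , trans (sym (corr-halfL u≢v h)) Ce , tailEdge-hit h

  C-entering : ∀ e {v} → C e ≡ true → tgt e ≡ orig v → ∃ λ u → N (ein u v) ≡ true × e ≡ headEdge u v
  C-entering (full u v) Ce refl with u≢v , h ← corr-valid (full u v) Ce =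
    u , ∧-conicalʳ (N (eout u v)) _ (trans (sym (corr-full u≢v h)) Ce) , headEdge-nonHit h
  C-entering (halfR u v) Ce refl with u≢v , h ← corr-valid (halfR u v) Ce =
    u , trans (sym (corr-halfR u≢v h)) Ce , headEdge-hit h

  successor : ∀ u → ∃ λ v → N (eout u v) ≡ true × (∀ v′ → N (eout u v′) ≡ true → v′ ≡ v)
  successor u with proj₂ N-perfect (vout u) tt
  ... | e , (Ne , e∋vout) , only with incident-vout e e∋vout
  ... | v , refl = v , Ne , λ v′ Nv′ → eout-injective (only (eout u v′) (Nv′ , inj₁ refl))
    where
    eout-injective : ∀ {v′} → eout u v′ ≡ eout u v → v′ ≡ v
    eout-injective refl = refl

  predecessor : ∀ v → ∃ λ u → N (ein u v) ≡ true × (∀ u′ → N (ein u′ v) ≡ true → u′ ≡ u)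
  predecessor v with proj₂ N-perfect (vin v) tt
  ... | e , (Ne , e∋vin) , only with incident-vin e e∋vin
  ... | u , refl = u , Ne , λ u′ Nu′ → ein-injective (only (ein u′ v) (Nu′ , inj₁ refl))
    where
    ein-injective : ∀ {u′} → ein u′ v ≡ ein u v → u′ ≡ u
    ein-injective refl = refl

  leavingEdge : ∀ u → ExactlyOne (Ẽ n) (λ e → C e ≡ true × src e ≡ orig u)
  leavingEdge u with v , Nout , only ← successor u =
    tailEdge u v , (C-tailEdge (N-valid Nout) Nout , src-tailEdge) , unique
    where
    unique : ∀ e → C e ≡ true × src e ≡ orig u → e ≡ tailEdge u v
    unique e (Ce , src≡u) with v′ , Nout′ , refl ← C-leaving e Ce src≡u = cong (tailEdge u) (only v′ Nout′)

  enteringEdge : ∀ v → ExactlyOne (Ẽ n) (λ e → C e ≡ true × tgt e ≡ orig v)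
  enteringEdge v with u , Nin , only ← predecessor v =
    headEdge u v , (C-headEdge (N-valid Nin) Nin , tgt-headEdge) , unique
    where
    unique : ∀ e → C e ≡ true × tgt e ≡ orig v → e ≡ headEdge u v
    unique e (Ce , tgt≡v) with u′ , Nin′ , refl ← C-entering e Ce tgt≡v = cong (λ x → headEdge x v) (only u′ Nin′)

  evadesAt : ∀ u v → hit w M u v ≡ true → EvadesAt C u v
  evadesAt u v h = GadgetUse⇒EvadesAt C (gadget h)
    (corr-halfL u≢v h) (corr-halfR u≢v h) (corr-halfL (u≢v ∘ sym) h′) (corr-halfR (u≢v ∘ sym) h′)
    where
    u≢v : u ≢ v
    u≢v = hit⇒≢ w M M-matching h
    h′ : hit w M v u ≡ true
    h′ = trans (hit-sym w M v u) h

  evading : IsEvadingCycleCover w M C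
  evading = corr-valid , leavingEdge , enteringEdge , evadesAt

  weightAt : ∀ u v →
    𝟙 (N (eout u v)) * 𝟙 (w u v) + 𝟙 (N (ein u v)) * 𝟙 (w u v) ≡
    𝟙 (C (full u v)) * (2 * 𝟙 (w u v)) + 𝟙 (C (halfL u v)) * 𝟙 (w u v) + 𝟙 (C (halfR u v)) * 𝟙 (w u v)
  weightAt u v with u ≟ v | hit w M u v in h
  ... | yes refl | _
    rewrite N-invalid {eout u u} (λ u≢u → u≢u refl) | N-invalid {ein u u} (λ u≢u → u≢u refl) = refl
  ... | no _    | true  = refl
  ... | no u≢v  | false rewrite out≡in u≢v h = doubled (N (ein u v)) (w u v)
    where
    doubled : ∀ x y → 𝟙 x * 𝟙 y + 𝟙 x * 𝟙 y ≡ 𝟙 (x ∧ x) * (2 * 𝟙 y) + 0 + 0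
    doubled true  true  = refl
    doubled true  false = refl
    doubled false _     = refl

  weight-corr : weight2N w N ≡ weight2C w C
  weight-corr = trans (weight2N≡Σ-eout-ein w N) (ΣF-cong λ u → ΣF-cong λ v → weightAt u v)

  pairedWith : ∀ {x y} → (∀ z → z ≡ x ⊎ z ≡ y) → N (eout x y) ≡ true × N (ein y x) ≡ true
  pairedWith {x} {y} x-or-y with z , Nz , _ ← successor x | z′ , Nz′ , _ ← predecessor x =
    subst (λ t → N (eout x t) ≡ true) (other (N-valid Nz ∘ sym)) Nz ,
    subst (λ t → N (ein t x) ≡ true) (other (N-valid Nz′)) Nz′
    where
    other : ∀ {z} → z ≢ x → z ≡ y
    other {z} z≢x with x-or-y z
    ... | inj₁ z≡x = contradiction z≡x z≢x
    ... | inj₂ z≡y = z≡y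

  noHitTwoCycle : ∀ {s} → IsHamiltonianCycle s → ∀ u → hit w M u (s u) ≡ true → s (s u) ≢ u
  noHitTwoCycle {s} s-cycle u h ssu≡u =
    GadgetUse-notAll (gadget h) (proj₁ (pairedWith u-or-v)) (proj₂ (pairedWith v-or-u))
                                (proj₁ (pairedWith v-or-u)) (proj₂ (pairedWith u-or-v))
    where
    u-or-v : ∀ x → x ≡ u ⊎ x ≡ s u
    u-or-v = period2⇒twoPoints s-cycle ssu≡u
    v-or-u : ∀ x → x ≡ s u ⊎ x ≡ u
    v-or-u x = Sum.swap (u-or-v x)

module TourMatching {n} (w M : Rel n) {s : Fin n → Fin n} (s-cycle : IsHamiltonianCycle s)
                    (noHitTwoCycle : ∀ u → hit w M u (s u) ≡ true → s (s u) ≢ u) where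

  uses : Fin n → Fin n → Bool
  uses u v = ⌊ s u ≟ v ⌋

  isGadget : Fin n → Fin n → Bool
  isGadget p q = ⌊ p <? q ⌋ ∧ hit w M p q

  reverseUsed reverseUnused : Fin n → Fin n → Bool
  reverseUsed   p q = isGadget p q ∧ uses q p
  reverseUnused p q = isGadget p q ∧ not (uses q p)

  -- The gadget of p < q is matched to e¹pq, e²pq if the tour uses (q,p), and to e²qp, e¹qp
  -- otherwise; the middle edge of (u,v) takes the e-vertices left over.
  Nₛ : E' n → Bool
  Nₛ (eout u v) = uses u v
  Nₛ (ein u v)  = uses u v
  Nₛ (emid u v) = not ⌊ u ≟ v ⌋ ∧ not (uses u v) ∧ not (reverseUsed u v) ∧ not (reverseUnused v u)
  Nₛ (ea1 p q)  = reverseUsed p q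
  Nₛ (eb2 p q)  = reverseUsed p q
  Nₛ (ea2 p q)  = reverseUnused p q
  Nₛ (eb1 p q)  = reverseUnused p q

  uses⇒≡ : ∀ {u v} → uses u v ≡ true → s u ≡ v
  uses⇒≡ {u} {v} with s u ≟ v
  ... | yes su≡v = λ _ → su≡v
  ... | no _     = λ ()

  ≡⇒uses : ∀ {u v} → s u ≡ v → uses u v ≡ true
  ≡⇒uses {u} {v} su≡v with s u ≟ v
  ... | yes _    = refl
  ... | no su≢v  = contradiction su≡v su≢v

  gadget-valid : ∀ {p q} x → isGadget p q ∧ x ≡ true → p < q × hit w M p q ≡ true
  gadget-valid {p} {q} x with p <? q | hit w M p q
  ... | yes p<q | true  = λ _ → p<q , refl
  ... | yes _   | false = λ ()
  ... | no _    | _     = λ ()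

  Nₛ-valid : ∀ e → Nₛ e ≡ true → ValidE' w M e
  Nₛ-valid (eout u v) Nₛe u≡v = proj₁ s-cycle u (trans (uses⇒≡ Nₛe) (sym u≡v))
  Nₛ-valid (ein u v)  Nₛe u≡v = proj₁ s-cycle u (trans (uses⇒≡ Nₛe) (sym u≡v))
  Nₛ-valid (emid u v) with u ≟ v
  ... | yes _   = λ ()
  ... | no u≢v  = λ _ → u≢v
  Nₛ-valid (ea1 p q) = gadget-valid _
  Nₛ-valid (ea2 p q) = gadget-valid _
  Nₛ-valid (eb1 p q) = gadget-valid _
  Nₛ-valid (eb2 p q) = gadget-valid _

  -- Nₛ on e1-edges u v for u < v and for v < u, with t = uses u v, t′ = uses v u, h = hit w M u v;
  -- e2-edges u v carry the same values.
  lowerEnd : ∀ t t′ h → (h ≡ true → t ≡ true → t′ ≢ true) →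
    OneOf₄ t (not t ∧ not (h ∧ t′) ∧ true) (h ∧ t′) false
  lowerEnd true  true  true  noBack = contradiction refl (noBack refl refl)
  lowerEnd true  false true  _      = 1st
  lowerEnd false true  true  _      = 3rd
  lowerEnd false false true  _      = 2nd
  lowerEnd true  _     false _      = 1st
  lowerEnd false _     false _      = 2nd

  upperEnd : ∀ t h → OneOf₄ t (not t ∧ not (h ∧ not t)) false (h ∧ not t)
  upperEnd true  true  = 1st
  upperEnd true  false = 1st
  upperEnd false true  = 4th
  upperEnd false false = 2nd

  Nₛ-e1 : ∀ {u v} → u ≢ v → OneOf₄ (uses u v) (Nₛ (emid u v)) (reverseUsed u v) (reverseUnused v u)
  Nₛ-e1 {u} {v} u≢v with u ≟ v | u <? v | v <? u
  ... | yes u≡v | _       | _       = contradiction u≡v u≢v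
  ... | no _    | yes u<v | yes v<u = contradiction v<u (<-asym u<v)
  ... | no _    | no u≮v  | no v≮u  = contradiction (≤-antisym (≮⇒≥ v≮u) (≮⇒≥ u≮v)) u≢v
  ... | no _    | yes _   | no _    = lowerEnd (uses u v) (uses v u) (hit w M u v) noBack
    where
    noBack : hit w M u v ≡ true → uses u v ≡ true → uses v u ≢ true
    noBack h su≡v sv≡u = noHitTwoCycle u (subst (λ x → hit w M u x ≡ true) (sym (uses⇒≡ su≡v)) h)
                                         (trans (cong s (uses⇒≡ su≡v)) (uses⇒≡ sv≡u))
  ... | no _    | no _    | yes _   = upperEnd (uses u v) (hit w M v u)

  Nₛ-a : ∀ {p q} → p < q → hit w M p q ≡ true → OneOf₂ (reverseUsed p q) (reverseUnused p q)
  Nₛ-a {p} {q} p<q h with p <? q | s q ≟ p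
  ... | no p≮q | _     = contradiction p<q p≮q
  ... | yes _  | yes _ rewrite h = 1st
  ... | yes _  | no _  rewrite h = 2nd

  Nₛ-b : ∀ {p q} → p < q → hit w M p q ≡ true → OneOf₂ (reverseUnused p q) (reverseUsed p q)
  Nₛ-b {p} {q} p<q h with p <? q | s q ≟ p
  ... | no p≮q | _     = contradiction p<q p≮q
  ... | yes _  | yes _ rewrite h = 2nd
  ... | yes _  | no _  rewrite h = 1st

  s-surjective : ∀ v → ∃ λ u → s u ≡ v
  s-surjective v with k , sᵏ⁺¹v≡v ← proj₂ s-cycle v v = iter s k v , sᵏ⁺¹v≡v

  perfectAt : ∀ {x cs} → Enumerates (IncE' x) cs → OneHot (map Nₛ cs) →
    ExactlyOne (E' n) (λ e → Nₛ e ≡ true × IncE' x e)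
  perfectAt {x} {cs} (_ , incident , enumerated) =
    oneHot⇒exactlyOne (IncE' x) Nₛ cs incident (λ e _ → enumerated e)

  matched : ∀ x → ValidV' w M x → ExactlyOne (E' n) (λ e → Nₛ e ≡ true × IncE' x e)
  matched (vout u) _ = eout u (s u) , (≡⇒uses refl , inj₁ refl) , unique
    where
    unique : ∀ e → Nₛ e ≡ true × IncE' (vout u) e → e ≡ eout u (s u)
    unique e (Nₛe , e∋vout) with v , refl ← incident-vout e e∋vout = cong (eout u) (sym (uses⇒≡ Nₛe))
  matched (vin v) _ with u , su≡v ← s-surjective v = ein u v , (≡⇒uses su≡v , inj₁ refl) , unique
    where
    unique : ∀ e → Nₛ e ≡ true × IncE' (vin v) e → e ≡ ein u v
    unique e (Nₛe , e∋vin) with u′ , refl ← incident-vin e e∋vin =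
      cong (λ x → ein x v) (surjective⇒injective s-surjective (trans (uses⇒≡ Nₛe) (sym su≡v)))
  matched (e1 u v) u≢v     = perfectAt e1-enumerates (oneOf₄⇒oneHot (Nₛ-e1 u≢v))
  matched (e2 u v) u≢v     = perfectAt e2-enumerates (oneOf₄⇒oneHot (Nₛ-e1 u≢v))
  matched (a p q) (p<q , h) = perfectAt a-enumerates (oneOf₂⇒oneHot (Nₛ-a p<q h))
  matched (b p q) (p<q , h) = perfectAt b-enumerates (oneOf₂⇒oneHot (Nₛ-b p<q h))

  perfect : IsPerfectMatching' w M Nₛ
  perfect = Nₛ-valid , matched

  tour≤weight : tourWeight2 w s ≤ weight2N w Nₛ
  tour≤weight = begin
    2 * ΣF (λ u → 𝟙 (w u (s u)))   ≡⟨ *-distribˡ-ΣF 2 (λ u → 𝟙 (w u (s u))) ⟩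
    ΣF (λ u → 2 * 𝟙 (w u (s u)))   ≤⟨ ΣF-mono (λ u → ≤-trans (≤-reflexive (tourEdge u)) (≤-ΣF _ (s u))) ⟩
    ΣF (λ u → ΣF (λ v → 𝟙 (uses u v) * 𝟙 (w u v) + 𝟙 (uses u v) * 𝟙 (w u v)))
                                    ≡⟨ sym (weight2N≡Σ-eout-ein w Nₛ) ⟩
    weight2N w Nₛ                   ∎
    where
    open ≤-Reasoning
    doubled : ∀ x → 2 * 𝟙 x ≡ 1 * 𝟙 x + 1 * 𝟙 x
    doubled true  = refl
    doubled false = refl
    tourEdge : ∀ u → 2 * 𝟙 (w u (s u)) ≡ 𝟙 (uses u (s u)) * 𝟙 (w u (s u)) + 𝟙 (uses u (s u)) * 𝟙 (w u (s u))
    tourEdge u rewrite ≡⇒uses {u} refl = doubled (w u (s u))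

theorem2 : (n : ℕ) (w M : Rel n) → IsMaxWeightMatching w M →
    (∀ (N : E' n → Bool) → IsPerfectMatching' w M N →
       IsEvadingCycleCover w M (corr w M N))
    × (∀ (N : E' n → Bool) → IsMaxWeightPerfectMatching' w M N →
         IsEvadingCycleCover w M (corr w M N)
         × (∀ (s : Fin n → Fin n) → IsHamiltonianCycle s →
              tourWeight2 w s ≤ weight2C w (corr w M N)))
theorem2 n w M (M-matching , _) = evading , maxWeight
  where
  evading : ∀ N → IsPerfectMatching' w M N → IsEvadingCycleCover w M (corr w M N)
  evading N N-perfect = PerfectMatching.evading M-matching N-perfect

  maxWeight : ∀ N → IsMaxWeightPerfectMatching' w M N →
    IsEvadingCycleCover w M (corr w M N)
    × (∀ s → IsHamiltonianCycle s → tourWeight2 w s ≤ weight2C w (corr w M N))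
  maxWeight N (N-perfect , N-max) = evading N N-perfect , λ s s-cycle →
    let open PerfectMatching M-matching N-perfect
        open TourMatching w M s-cycle (noHitTwoCycle s-cycle)
        open ≤-Reasoning
    in begin
      tourWeight2 w s          ≤⟨ tour≤weight ⟩
      weight2N w Nₛ            ≤⟨ N-max Nₛ perfect ⟩
      weight2N w N             ≡⟨ weight-corr ⟩
      weight2C w (corr w M N)  ∎
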